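{- Let $f\in\mathbb Q_p[x]$ be an integer-valued, compatible and ergodic polynomial of degree $d$. Let $x_0\in\mathbb Z_p$ and define $x_{n+1}=f(x_n)$ for $n\ge0$. Suppose there is a positive integer $r$ such that for every $k\in\mathbb N$ there exist $c,c_0,\dots,c_r\in\mathbb Z_p$, not all congruent to $0$ modulo $p$, with $c+\sum_{i=0}^{r}c_ix_{n+i}\equiv 0\pmod{p^k}$ for all $n=0,1,2,\dots$. Then $d=1$.
   Context: $\mathbb Q_p$, $\mathbb Z_p$, $\|\cdot\|_p$ are the $p$-adic numbers, integers and norm. A polynomial $f\in\mathbb Q_p[x]$ is integer-valued if $f(\mathbb Z_p)\subseteq\mathbb Z_p$, compatible if $\|f(x)-f(y)\|_p\le\|x-y\|_p$ for all $x,y\in\mathbb Z_p$, and (for compatible $f$) ergodic with respect to the normalized Haar measure, which is equivalent to $f$ inducing a single-cycle permutation of $\mathbb Z/p^k$ for every $k\ge1$. -}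

module Defs where

open import Data.Nat using (ℕ; zero; suc; _+_; _*_; _^_; _<_; _≤_)
open import Data.Nat.Properties using (m^n≢0)
open import Data.Nat.DivMod using (_%_; _/_)
open import Data.Fin using (Fin; toℕ; fromℕ)
open import Data.Vec using (Vec; lookup; tabulate; sum)
open import Data.Product using (Σ; ∃; _×_)
open import Relation.Binary.PropositionalEquality using (_≡_)
open import Relation.Nullary using (¬_)

-- n mod p^k  (the case p = 0 is a dummy; p is always a prime below)
_mod[_^_] : ℕ → ℕ → ℕ → ℕ
n mod[ zero ^ k ] = 0
n mod[ suc p ^ k ] = _%_ n (suc p ^ k) {{m^n≢0 (suc p) k}}

_div[_^_] : ℕ → ℕ → ℕ → ℕ
n div[ zero ^ k ] = 0
n div[ suc p ^ k ] = _/_ n (suc p ^ k) {{m^n≢0 (suc p) k}}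

-- p-adic integers as coherent sequences of residues:
-- digit k ∈ {0,…,p^k-1} is the residue mod p^k (inverse limit of ℤ/p^k).
record ℤ[_] (p : ℕ) : Set where
  constructor mkℤp
  field
    digit    : ℕ → ℕ
    coherent : ∀ k → digit k ≡ (digit (suc k)) mod[ p ^ k ]
open ℤ[_] public

-- A polynomial f ∈ ℚ_p[x] of formal degree ≤ d, written as f = g / p^m
-- with g ∈ ℤ_p[x] (every element of ℚ_p[x] has this form).
record QpPoly (p d : ℕ) : Set where
  constructor mkQpPoly
  field
    numer  : Vec (ℤ[ p ]) (suc d)
    denExp : ℕ
open QpPoly public

HasDegree : ∀ {p d} → QpPoly p d → Set
HasDegree {p} {d} f = ∃ λ k → ¬ (digit (lookup (numer f) (fromℕ d)) k ≡ 0)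

numerMod : ∀ {p d} → QpPoly p d → (ℕ → ℕ) → ℕ → ℕ
numerMod {p} f x k =
  (sum (tabulate λ i → digit (lookup (numer f) i) k * x k ^ toℕ i)) mod[ p ^ k ]

-- f integer-valued: f(x) = g(x)/p^m ∈ ℤ_p, i.e. g(x) ≡ 0 mod p^m, for all x ∈ ℤ_p
IntegerValued : ∀ {p d} → QpPoly p d → Set
IntegerValued {p} f = ∀ (x : ℤ[ p ]) → numerMod f (digit x) (denExp f) ≡ 0

-- residue of f(x) mod p^k (meaningful when f is integer-valued)
fval : ∀ {p d} → QpPoly p d → (ℕ → ℕ) → ℕ → ℕ
fval {p} f x k = (numerMod f x (k + denExp f)) div[ p ^ denExp f ]

-- compatible: ‖f(x)-f(y)‖_p ≤ ‖x-y‖_p, i.e. x ≡ y (mod p^k) ⇒ f(x) ≡ f(y) (mod p^k) for all k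
Compatible : ∀ {p d} → QpPoly p d → Set
Compatible {p} f = ∀ (x y : ℤ[ p ]) (k : ℕ) → digit x k ≡ digit y k → fval f (digit x) k ≡ fval f (digit y) k

iter : {A : Set} → (A → A) → ℕ → A → A
iter g zero a = a
iter g (suc n) a = g (iter g n a)

inducedMod : ∀ {p d} → QpPoly p d → ℕ → ℕ → ℕ
inducedMod {p} f k t = fval f (λ j → t mod[ p ^ j ]) k

-- ergodic (for compatible f): f induces a single-cycle permutation of ℤ/p^k for every k ≥ 1;
-- on a finite set this is: every residue b is reached from every residue a by iterating
Ergodic : ∀ {p d} → QpPoly p d → Set
Ergodic {p} f = ∀ (k : ℕ) → 1 ≤ k → ∀ a b → a < p ^ k → b < p ^ k →
  ∃ λ n → iter (inducedMod f k) n a ≡ b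

orbit : ∀ {p d} → QpPoly p d → ℤ[ p ] → ℕ → (ℕ → ℕ)
orbit f x₀ zero = digit x₀
orbit f x₀ (suc n) = fval f (orbit f x₀ n)

LinearRecurrenceModAll : ∀ {p d} → QpPoly p d → ℤ[ p ] → ℕ → Set
LinearRecurrenceModAll {p} f x₀ r = ∀ (k : ℕ) →
  Σ (ℤ[ p ]) λ c → Σ (Vec (ℤ[ p ]) (suc r)) λ cs →
    ¬ ((digit c 1 ≡ 0) × (∀ i → digit (lookup cs i) 1 ≡ 0)) ×
    (∀ (n : ℕ) →
      (digit c k + sum (tabulate λ i → digit (lookup cs i) k * orbit f x₀ (n + toℕ i) k))
        mod[ p ^ k ] ≡ 0)

module Submission where

-- Write f = g / p^m with g integral, read modulo a large power p^L.  The rescaled iterates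
-- H₀ t = t, H_{i+1} = p^(d s_i) g(H_i / p^(s_i)) are integer polynomials of degree d^i whose
-- leading coefficients have p-adic valuation bounded independently of the precision k, and
-- along an orbit H_i(x_n) = p^(s_i) y with y ≡ x_{n+i} (mod p^k).  By ergodicity every t ≤ d^r
-- is some x_n modulo p^k, so the assumed relation makes p^(s_r) c + Σ c_i p^(s_r - s_i) H_i(t)
-- vanish modulo p^(k + s_r) for all t ≤ d^r.  When d ≥ 2 the degrees d^i are distinct, so the
-- finite difference of order d^j isolates c_j; downward induction on j gives p^k ∣ p^((r+1)β) c_j
-- for all j, and then p^k ∣ p^((r+1)β) c.  As k > (r+1)β, p divides c and every c_i, contradicting
-- the hypothesis.  A constant map is not ergodic, which rules out d = 0.

open import Defs
open import Data.Nat using (ℕ; _≤_)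
open import Data.Nat.Primality using (Prime)
open import Relation.Binary.PropositionalEquality using (_≡_)

module FiniteDifference where

  open import Data.Nat as ℕ using (ℕ; zero; suc; _!; _≤_; _<_; s≤s)
  import Data.Nat.Properties as ℕ
  open import Data.Integer using (ℤ; +_; _+_; _-_; _*_; 0ℤ; 1ℤ; _^_)
  open import Data.Integer.Properties
  open import Data.Integer.Divisibility.Signed using (_∣_; ∣m∣n⇒∣m-n)
  open import Data.Integer.Tactic.RingSolver using (solve-∀)
  open import Data.Fin as Fin using (Fin)
  open import Data.Sum using (inj₁; inj₂)
  open import Algebra.Properties.Semiring.Sum +-*-semiring using (sum)
  open import Relation.Binary.PropositionalEquality

  Δ : (ℕ → ℤ) → ℕ → ℤ
  Δ φ t = φ (suc t) - φ t

  Δ^ : ℕ → (ℕ → ℤ) → ℕ → ℤ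
  Δ^ zero    φ = φ
  Δ^ (suc n) φ = Δ^ n (Δ φ)

  -- Poly n a φ: φ agrees on ℕ with a polynomial of degree ≤ n whose coefficient of tⁿ is a.
  -- This is encoded through Δ, which lowers the degree by one and multiplies that
  -- coefficient by the degree.
  Poly : ℕ → ℤ → (ℕ → ℤ) → Set
  Poly zero    a φ = ∀ t → φ t ≡ a
  Poly (suc n) a φ = Poly n (+ suc n * a) (Δ φ)

  Δ-cong : ∀ {φ ψ} → φ ≗ ψ → Δ φ ≗ Δ ψ
  Δ-cong φ≗ψ t = cong₂ _-_ (φ≗ψ (suc t)) (φ≗ψ t)

  Δ^-cong : ∀ n {φ ψ} → φ ≗ ψ → Δ^ n φ ≗ Δ^ n ψ
  Δ^-cong zero    φ≗ψ = φ≗ψ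
  Δ^-cong (suc n) φ≗ψ = Δ^-cong n (Δ-cong φ≗ψ)

  Poly-cong : ∀ n {a φ ψ} → φ ≗ ψ → Poly n a φ → Poly n a ψ
  Poly-cong zero    φ≗ψ φ-poly t = trans (sym (φ≗ψ t)) (φ-poly t)
  Poly-cong (suc n) φ≗ψ φ-poly = Poly-cong n (Δ-cong φ≗ψ) φ-poly

  Poly-resp-lead : ∀ n {a b φ} → a ≡ b → Poly n a φ → Poly n b φ
  Poly-resp-lead n {φ = φ} a≡b = subst (λ c → Poly n c φ) a≡b

  Δ^-top : ∀ n {a φ} → Poly n a φ → ∀ t → Δ^ n φ t ≡ + (n !) * a
  Δ^-top zero    {a} φ-poly t = trans (φ-poly t) (sym (*-identityˡ a))
  Δ^-top (suc n) {a} {φ} φ-poly t = begin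
    Δ^ n (Δ φ) t           ≡⟨ Δ^-top n φ-poly t ⟩
    + (n !) * (+ suc n * a) ≡⟨ sym (*-assoc (+ (n !)) (+ suc n) a) ⟩
    + (n !) * + suc n * a   ≡⟨ cong (_* a) (sym (pos-* (n !) (suc n))) ⟩
    + (n ! ℕ.* suc n) * a   ≡⟨ cong (λ m → + m * a) (ℕ.*-comm (n !) (suc n)) ⟩
    + (suc n !) * a         ∎
    where open ≡-Reasoning

  Poly-const : ∀ a → Poly 0 a (λ _ → a)
  Poly-const a t = refl

  Poly-id : Poly 1 1ℤ (λ t → + t)
  Poly-id t = identity (+ t)
    where
    identity : ∀ x → (1ℤ + x) - x ≡ 1ℤ
    identity = solve-∀

  Poly-lift : ∀ n {a φ} → Poly n a φ → Poly (suc n) 0ℤ φ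
  Poly-lift zero    {a} φ-poly t = trans (cong₂ _-_ (φ-poly (suc t)) (φ-poly t)) (+-inverseʳ a)
  Poly-lift (suc n) {φ = φ} φ-poly =
    Poly-resp-lead (suc n) {φ = Δ φ} (sym (*-zeroʳ (+ suc (suc n)))) (Poly-lift n φ-poly)

  Poly-lift< : ∀ n N {a φ} → n < N → Poly n a φ → Poly N 0ℤ φ
  Poly-lift< n (suc N) (s≤s n≤N) φ-poly with ℕ.m≤n⇒m<n∨m≡n n≤N
  ... | inj₂ refl = Poly-lift n φ-poly
  ... | inj₁ n<N  = Poly-lift N (Poly-lift< n N n<N φ-poly)

  Poly-zero : ∀ n → Poly n 0ℤ (λ _ → 0ℤ)
  Poly-zero zero    t = refl
  Poly-zero (suc n) = Poly-resp-lead n (sym (*-zeroʳ (+ suc n))) (Poly-zero n)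

  Poly-+ : ∀ n {a b φ ψ} → Poly n a φ → Poly n b ψ → Poly n (a + b) (λ t → φ t + ψ t)
  Poly-+ zero    φ-poly ψ-poly t = cong₂ _+_ (φ-poly t) (ψ-poly t)
  Poly-+ (suc n) {a} {b} {φ} {ψ} φ-poly ψ-poly =
    Poly-resp-lead n (sym (*-distribˡ-+ (+ suc n) a b))
      (Poly-cong n (λ t → Δ-+ (φ (suc t)) (φ t) (ψ (suc t)) (ψ t)) (Poly-+ n φ-poly ψ-poly))
    where
    Δ-+ : ∀ x y u v → (x - y) + (u - v) ≡ (x + u) - (y + v)
    Δ-+ = solve-∀

  Poly-*ˡ : ∀ n c {a φ} → Poly n a φ → Poly n (c * a) (λ t → c * φ t)
  Poly-*ˡ zero    c φ-poly t = cong (c *_) (φ-poly t)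
  Poly-*ˡ (suc n) c {a} {φ} φ-poly =
    Poly-resp-lead n (swap (+ suc n) c a)
      (Poly-cong n (λ t → Δ-*ˡ c (φ (suc t)) (φ t)) (Poly-*ˡ n c φ-poly))
    where
    Δ-*ˡ : ∀ c x y → c * (x - y) ≡ c * x - c * y
    Δ-*ˡ = solve-∀
    swap : ∀ x y z → y * (x * z) ≡ x * (y * z)
    swap = solve-∀

  Poly-shift : ∀ n {a φ} → Poly n a φ → Poly n a (λ t → φ (suc t))
  Poly-shift zero    φ-poly t = φ-poly (suc t)
  Poly-shift (suc n) φ-poly = Poly-shift n φ-poly

  -- Product rule: Δ(φψ)(t) = Δφ(t) ψ(t+1) + φ(t) Δψ(t).
  Poly-* : ∀ n l {a b φ ψ} → Poly n a φ → Poly l b ψ → Poly (n ℕ.+ l) (a * b) (λ t → φ t * ψ t)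
  Poly-* zero l {a} {b} {φ} {ψ} φ-poly ψ-poly =
    Poly-cong l (λ t → cong (_* ψ t) (sym (φ-poly t))) (Poly-*ˡ l a {φ = ψ} ψ-poly)
  Poly-* (suc n) zero {a} {b} {φ} {ψ} φ-poly ψ-poly =
    subst (λ m → Poly m (a * b) (λ t → φ t * ψ t)) (sym (ℕ.+-identityʳ (suc n)))
      (Poly-resp-lead (suc n) {φ = λ t → φ t * ψ t} (*-comm b a)
        (Poly-cong (suc n) (λ t → trans (cong (_* φ t) (sym (ψ-poly t))) (*-comm (ψ t) (φ t)))
          (Poly-*ˡ (suc n) b {φ = φ} φ-poly)))
  Poly-* (suc n) (suc l) {a} {b} {φ} {ψ} φ-poly ψ-poly =
    Poly-resp-lead (n ℕ.+ suc l) {φ = Δ (λ t → φ t * ψ t)} lead-eq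
      (Poly-cong (n ℕ.+ suc l) (λ t → product-rule (φ (suc t)) (φ t) (ψ (suc t)) (ψ t))
        (Poly-+ (n ℕ.+ suc l) Δφ·ψ φ·Δψ))
    where
    Δφ·ψ : Poly (n ℕ.+ suc l) ((+ suc n * a) * b) (λ t → Δ φ t * ψ (suc t))
    Δφ·ψ = Poly-* n (suc l) {φ = Δ φ} {ψ = λ t → ψ (suc t)} φ-poly (Poly-shift (suc l) {b} {ψ} ψ-poly)
    φ·Δψ : Poly (n ℕ.+ suc l) (a * (+ suc l * b)) (λ t → φ t * Δ ψ t)
    φ·Δψ = subst (λ m → Poly m (a * (+ suc l * b)) (λ t → φ t * Δ ψ t)) (sym (ℕ.+-suc n l))
             (Poly-* (suc n) l {φ = φ} {ψ = Δ ψ} φ-poly ψ-poly)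
    product-rule : ∀ x y u v → (x - y) * u + y * (u - v) ≡ x * u - y * v
    product-rule = solve-∀
    collect : ∀ x y a b → (x * a) * b + a * (y * b) ≡ (x + y) * (a * b)
    collect = solve-∀
    lead-eq : (+ suc n * a) * b + a * (+ suc l * b) ≡ + suc (n ℕ.+ suc l) * (a * b)
    lead-eq = trans (collect (+ suc n) (+ suc l) a b) (cong (_* (a * b)) (sym (pos-+ (suc n) (suc l))))

  Poly-^ : ∀ n {a φ} → Poly n a φ → ∀ j → Poly (j ℕ.* n) (a ^ j) (λ t → φ t ^ j)
  Poly-^ n φ-poly zero    t = refl
  Poly-^ n {φ = φ} φ-poly (suc j) =
    Poly-* n (j ℕ.* n) {φ = φ} {ψ = λ t → φ t ^ j} φ-poly (Poly-^ n φ-poly j)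

  Poly-sum : ∀ N {n} {a : Fin n → ℤ} {F : Fin n → ℕ → ℤ} →
             (∀ i → Poly N (a i) (F i)) → Poly N (sum a) (λ t → sum (λ i → F i t))
  Poly-sum N {zero}  F-poly = Poly-zero N
  Poly-sum N {suc n} F-poly = Poly-+ N (F-poly Fin.zero) (Poly-sum N (λ i → F-poly (Fin.suc i)))

  Δ^-vanish : ∀ n N {a φ} → n < N → Poly n a φ → ∀ t → Δ^ N φ t ≡ 0ℤ
  Δ^-vanish n N n<N φ-poly t =
    trans (Δ^-top N (Poly-lift< n N n<N φ-poly) t) (*-zeroʳ (+ (N !)))

  Δ^-+ : ∀ n φ ψ t → Δ^ n (λ t → φ t + ψ t) t ≡ Δ^ n φ t + Δ^ n ψ t
  Δ^-+ zero    φ ψ t = refl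
  Δ^-+ (suc n) φ ψ t =
    trans (Δ^-cong n (λ t → Δ-+ (φ (suc t)) (φ t) (ψ (suc t)) (ψ t)) t) (Δ^-+ n (Δ φ) (Δ ψ) t)
    where
    Δ-+ : ∀ x y u v → (x + u) - (y + v) ≡ (x - y) + (u - v)
    Δ-+ = solve-∀

  Δ^-*ˡ : ∀ n c φ t → Δ^ n (λ t → c * φ t) t ≡ c * Δ^ n φ t
  Δ^-*ˡ zero    c φ t = refl
  Δ^-*ˡ (suc n) c φ t =
    trans (Δ^-cong n (λ t → Δ-*ˡ c (φ (suc t)) (φ t)) t) (Δ^-*ˡ n c (Δ φ) t)
    where
    Δ-*ˡ : ∀ c x y → c * x - c * y ≡ c * (x - y)
    Δ-*ˡ = solve-∀

  Δ^-const : ∀ n a t → Δ^ (suc n) (λ _ → a) t ≡ 0ℤ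
  Δ^-const n a = Δ^-vanish 0 (suc n) (s≤s ℕ.z≤n) (Poly-const a)

  Δ^-sum : ∀ N {n} (F : Fin n → ℕ → ℤ) t → Δ^ N (λ t → sum (λ i → F i t)) t ≡ sum (λ i → Δ^ N (F i) t)
  Δ^-sum N {zero}  F t = trans (Δ^-top N (Poly-zero N) t) (*-zeroʳ (+ (N !)))
  Δ^-sum N {suc n} F t =
    trans (Δ^-+ N (F Fin.zero) (λ t → sum (λ i → F (Fin.suc i) t)) t)
          (cong (λ s → Δ^ N (F Fin.zero) t + s) (Δ^-sum N (λ i → F (Fin.suc i)) t))

  Δ^-∣ : ∀ M j T φ → (∀ t → t ≤ j ℕ.+ T → M ∣ φ t) → ∀ t → t ≤ T → M ∣ Δ^ j φ t
  Δ^-∣ M zero    T φ M∣φ = M∣φ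
  Δ^-∣ M (suc j) T φ M∣φ = Δ^-∣ M j T (Δ φ)
    (λ t t≤j+T → ∣m∣n⇒∣m-n (M∣φ (suc t) (s≤s t≤j+T)) (M∣φ t (ℕ.m≤n⇒m≤1+n t≤j+T)))

module PrimePowerDivisibility where

  open import Data.Nat
  open import Data.Nat.Properties
  open import Data.Nat.Divisibility
  open import Data.Nat.Primality using (Prime; euclidsLemma)
  open import Data.Nat.Tactic.RingSolver using (solve-∀)
  open import Data.Product using (∃₂; _×_; _,_)
  open import Function using (_∘_)
  open import Data.Sum using (inj₁; inj₂)
  open import Data.Empty using (⊥-elim)
  open import Relation.Nullary using (¬_; yes; no)
  open import Relation.Binary.PropositionalEquality

  ^-monoʳ-∣ : ∀ p {a b} → a ≤ b → p ^ a ∣ p ^ b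
  ^-monoʳ-∣ p {a} {b} a≤b = divides (p ^ (b ∸ a)) (begin
    p ^ b             ≡⟨ cong (p ^_) (sym (m∸n+n≡m a≤b)) ⟩
    p ^ (b ∸ a + a)   ≡⟨ ^-distribˡ-+-* p (b ∸ a) a ⟩
    p ^ (b ∸ a) * p ^ a ∎)
    where open ≡-Reasoning

  cumulative : (ℕ → ℕ) → ℕ → ℕ
  cumulative b zero    = b zero
  cumulative b (suc r) = b (suc r) + cumulative b r

  ≤-cumulative : ∀ b {i r} → i ≤ r → b i ≤ cumulative b r
  ≤-cumulative b {zero}  {zero}  _ = ≤-refl
  ≤-cumulative b {i}     {suc r} i≤r+1 with m≤n⇒m<n∨m≡n i≤r+1
  ... | inj₁ i<r+1 = ≤-trans (≤-cumulative b (≤-pred i<r+1)) (m≤n+m (cumulative b r) (b (suc r)))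
  ... | inj₂ refl  = m≤m+n (b (suc r)) (cumulative b r)

  module PrimePower (q : ℕ) (prime : Prime (suc (suc q))) where

    private
      p : ℕ
      p = suc (suc q)

    split-power : ∀ n → n ≢ 0 → ∃₂ λ v u → n ≡ p ^ v * u × ¬ p ∣ u
    split-power n = go n n ≤-refl
      where
      go : ∀ fuel n → n ≤ fuel → n ≢ 0 → ∃₂ λ v u → n ≡ p ^ v * u × ¬ p ∣ u
      go fuel n n≤fuel n≢0 with p ∣? n
      ... | no p∤n = 0 , n , sym (+-identityʳ n) , p∤n
      go zero n n≤0 n≢0 | yes _ = ⊥-elim (n≢0 (n≤0⇒n≡0 n≤0))
      go (suc fuel) n n≤fuel n≢0 | yes (divides n′ refl)
        with go fuel n′ (≤-pred (≤-trans n′<n n≤fuel)) (λ { refl → n≢0 refl })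
        where
        n′<n : n′ < n′ * p
        n′<n = m<m*n n′ p ⦃ ≢-nonZero λ { refl → n≢0 refl } ⦄ (s≤s (s≤s z≤n))
      ... | v , u , refl , p∤u = suc v , u , reassoc (p ^ v) u p , p∤u
        where
        reassoc : ∀ a b x → a * b * x ≡ x * a * b
        reassoc = solve-∀

    ^∣-cancel-unit : ∀ {u} → ¬ p ∣ u → ∀ K Y → p ^ K ∣ u * Y → p ^ K ∣ Y
    ^∣-cancel-unit p∤u zero    Y _ = 1∣ Y
    ^∣-cancel-unit {u} p∤u (suc K) Y p^K+1∣uY
      with euclidsLemma u Y prime (∣-trans (divides (p ^ K) (*-comm p (p ^ K))) p^K+1∣uY)
    ... | inj₁ p∣u = ⊥-elim (p∤u p∣u)
    ... | inj₂ (divides Y′ refl) = subst (p * p ^ K ∣_) (*-comm p Y′) (*-monoʳ-∣ p p^K∣Y′)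
      where
      reassoc : ∀ u y x → u * (y * x) ≡ x * (u * y)
      reassoc = solve-∀
      p^K∣Y′ : p ^ K ∣ Y′
      p^K∣Y′ = ^∣-cancel-unit p∤u K Y′
                 (*-cancelˡ-∣ p (subst (p * p ^ K ∣_) (reassoc u Y′ p) p^K+1∣uY))

    exponent< : ∀ v u a → ¬ p ^ a ∣ p ^ v * u → v < a
    exponent< v u a p^a∤n with v <? a
    ... | yes v<a = v<a
    ... | no v≮a  = ⊥-elim (p^a∤n (∣-trans (^-monoʳ-∣ p (≮⇒≥ v≮a)) (m∣m*n u)))

    ^∣-cancel-^∤ : ∀ {β X c K} → ¬ p ^ β ∣ X → p ^ K ∣ c * X → p ^ K ∣ p ^ β * c
    ^∣-cancel-^∤ {β} {X} {c} {K} p^β∤X p^K∣cX with X ≟ 0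
    ... | yes refl = ⊥-elim (p^β∤X (divides 0 refl))
    ... | no X≢0 with split-power X X≢0
    ... | v , u , refl , p∤u =
      ∣-trans p^K∣p^vc (*-monoˡ-∣ c (^-monoʳ-∣ p (<⇒≤ (exponent< v u β p^β∤X))))
      where
      reassoc : ∀ c a u → c * (a * u) ≡ u * (a * c)
      reassoc = solve-∀
      p^K∣p^vc : p ^ K ∣ p ^ v * c
      p^K∣p^vc = ^∣-cancel-unit p∤u K (p ^ v * c) (subst (p ^ K ∣_) (reassoc c (p ^ v) u) p^K∣cX)

    ^∤-* : ∀ a b {x y} → ¬ p ^ a ∣ x → ¬ p ^ b ∣ y → ¬ p ^ (a + b) ∣ x * y
    ^∤-* a b {x} {y} p^a∤x p^b∤y p^a+b∣xy with x ≟ 0 | y ≟ 0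
    ... | yes refl | _        = p^a∤x (divides 0 refl)
    ... | no _     | yes refl = p^b∤y (divides 0 refl)
    ... | no x≢0   | no y≢0 with split-power x x≢0 | split-power y y≢0
    ... | v , u , refl , p∤u | w , u′ , refl , p∤u′ with euclidsLemma u u′ prime p∣uu′
      where
      reassoc : ∀ a b u u′ → (a * u) * (b * u′) ≡ (a * b) * (u * u′)
      reassoc = solve-∀
      v+w<a+b : suc (v + w) ≤ a + b
      v+w<a+b = +-mono-≤ (exponent< v u a p^a∤x) (<⇒≤ (exponent< w u′ b p^b∤y))
      p^v+w+1∣p^v+w*uu′ : p ^ (v + w) * p ∣ p ^ (v + w) * (u * u′)
      p^v+w+1∣p^v+w*uu′ =
        ∣-trans (subst (_∣ p ^ (a + b)) (*-comm p (p ^ (v + w))) (^-monoʳ-∣ p v+w<a+b))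
          (subst (p ^ (a + b) ∣_)
            (trans (reassoc (p ^ v) (p ^ w) u u′) (cong (_* (u * u′)) (sym (^-distribˡ-+-* p v w))))
            p^a+b∣xy)
      p∣uu′ : p ∣ u * u′
      p∣uu′ = *-cancelˡ-∣ (p ^ (v + w)) ⦃ m^n≢0 p (v + w) ⦄ p^v+w+1∣p^v+w*uu′
    ... | inj₁ p∣u  = p∤u p∣u
    ... | inj₂ p∣u′ = p∤u′ p∣u′

    n<p^n : ∀ n → n < p ^ n
    n<p^n zero    = s≤s z≤n
    n<p^n (suc n) = begin-strict
      suc n             <⟨ s≤s (n<p^n n) ⟩
      1 + p ^ n         ≤⟨ +-monoˡ-≤ (p ^ n) (m^n>0 p n) ⟩
      p ^ n + p ^ n     ≤⟨ +-monoʳ-≤ (p ^ n) (m≤m+n (p ^ n) (q * p ^ n)) ⟩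
      p ^ (suc n)       ∎
      where open ≤-Reasoning

    p^n∤n : ∀ n → 0 < n → ¬ p ^ n ∣ n
    p^n∤n n 0<n p^n∣n = <⇒≱ (n<p^n n) (∣⇒≤ ⦃ >-nonZero 0<n ⦄ p^n∣n)

    ^∤-^ : ∀ a {x} → ¬ p ^ a ∣ x → ∀ j → ¬ p ^ suc (j * a) ∣ x ^ j
    ^∤-^ a p^a∤x zero    = p^n∤n 1 (s≤s z≤n)
    ^∤-^ a {x} p^a∤x (suc j) =
      ^∤-* a (suc (j * a)) p^a∤x (^∤-^ a p^a∤x j) ∘ subst (λ e → p ^ e ∣ x ^ suc j) (sym (+-suc a (j * a)))

    ^∤-mono : ∀ {a b x} → a ≤ b → ¬ p ^ a ∣ x → ¬ p ^ b ∣ x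
    ^∤-mono a≤b p^a∤x p^b∣x = p^a∤x (∣-trans (^-monoʳ-∣ p a≤b) p^b∣x)

module Residues where

  open PrimePowerDivisibility using (^-monoʳ-∣)
  open import Data.Nat
  open import Data.Nat.Properties
  open import Data.Nat.DivMod
  open import Data.Fin as Fin using (Fin)
  open import Data.Vec using (tabulate; sum)
  open import Relation.Binary.PropositionalEquality
  open import Function using (_∘_)

  module Residue (q : ℕ) where

    private
      p : ℕ
      p = suc (suc q)

    p^≢0 : ∀ k → NonZero (p ^ k)
    p^≢0 k = m^n≢0 p k

    infix 4 _≋[_]_
    _≋[_]_ : ℕ → ℕ → ℕ → Set
    a ≋[ k ] b = a mod[ p ^ k ] ≡ b mod[ p ^ k ]

    mod< : ∀ k a → a mod[ p ^ k ] < p ^ k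
    mod< k a = m%n<n a (p ^ k) ⦃ p^≢0 k ⦄

    mod-small : ∀ k {a} → a < p ^ k → a mod[ p ^ k ] ≡ a
    mod-small k = m<n⇒m%n≡m ⦃ p^≢0 k ⦄

    mod-mod : ∀ {a b} x → a ≤ b → (x mod[ p ^ b ]) mod[ p ^ a ] ≡ x mod[ p ^ a ]
    mod-mod {a} {b} x a≤b = m∣n⇒o%n%m≡o%m (p ^ a) (p ^ b) x ⦃ p^≢0 a ⦄ ⦃ p^≢0 b ⦄ (^-monoʳ-∣ p a≤b)

    mod-≋ : ∀ k x → x mod[ p ^ k ] ≋[ k ] x
    mod-≋ k x = m%n%n≡m%n x (p ^ k) ⦃ p^≢0 k ⦄

    ≋-+ : ∀ k {a a′ b b′} → a ≋[ k ] a′ → b ≋[ k ] b′ → a + b ≋[ k ] a′ + b′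
    ≋-+ k {a} {a′} {b} {b′} a≋a′ b≋b′ = trans (%-distribˡ-+ a b (p ^ k) ⦃ p^≢0 k ⦄)
      (trans (cong₂ (λ u v → (u + v) mod[ p ^ k ]) a≋a′ b≋b′) (sym (%-distribˡ-+ a′ b′ (p ^ k) ⦃ p^≢0 k ⦄)))

    ≋-* : ∀ k {a a′ b b′} → a ≋[ k ] a′ → b ≋[ k ] b′ → a * b ≋[ k ] a′ * b′
    ≋-* k {a} {a′} {b} {b′} a≋a′ b≋b′ = trans (%-distribˡ-* a b (p ^ k) ⦃ p^≢0 k ⦄)
      (trans (cong₂ (λ u v → (u * v) mod[ p ^ k ]) a≋a′ b≋b′) (sym (%-distribˡ-* a′ b′ (p ^ k) ⦃ p^≢0 k ⦄)))

    ≋-^ : ∀ k {a a′} → a ≋[ k ] a′ → ∀ j → a ^ j ≋[ k ] a′ ^ j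
    ≋-^ k a≋a′ zero    = refl
    ≋-^ k a≋a′ (suc j) = ≋-* k a≋a′ (≋-^ k a≋a′ j)

    ≋-sum : ∀ k {n} (h h′ : Fin n → ℕ) → (∀ i → h i ≋[ k ] h′ i) →
            sum (tabulate h) ≋[ k ] sum (tabulate h′)
    ≋-sum k {zero}  h h′ h≋h′ = refl
    ≋-sum k {suc n} h h′ h≋h′ =
      ≋-+ k (h≋h′ Fin.zero) (≋-sum k (h ∘ Fin.suc) (h′ ∘ Fin.suc) (h≋h′ ∘ Fin.suc))

    mod-div : ∀ k m x → (x mod[ p ^ (k + m) ]) div[ p ^ m ] ≡ (x div[ p ^ m ]) mod[ p ^ k ]
    mod-div k m x =
      trans (cong (λ y → _/_ y (p ^ m) ⦃ p^≢0 m ⦄)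
                  (%-congʳ ⦃ p^≢0 (k + m) ⦄ ⦃ p^k*p^m≢0 ⦄ (^-distribˡ-+-* p k m)))
            (m%[n*o]/o≡m/o%n x (p ^ k) (p ^ m) ⦃ p^≢0 k ⦄ ⦃ p^≢0 m ⦄ ⦃ p^k*p^m≢0 ⦄)
      where
      p^k*p^m≢0 : NonZero (p ^ k * p ^ m)
      p^k*p^m≢0 = subst NonZero (^-distribˡ-+-* p k m) (m^n≢0 p (k + m))

    *-mod-div : ∀ k m a → ((p ^ m * a) mod[ p ^ (k + m) ]) div[ p ^ m ] ≡ a mod[ p ^ k ]
    *-mod-div k m a = trans (mod-div k m (p ^ m * a))
      (cong (_mod[ p ^ k ]) (trans (cong (λ y → _/_ y (p ^ m) ⦃ p^≢0 m ⦄) (*-comm (p ^ m) a))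
                                  (m*n/n≡m a (p ^ m) ⦃ p^≢0 m ⦄)))

    digit< : (x : ℤ[ p ]) → ∀ k → digit x k < p ^ k
    digit< x k = subst (_< p ^ k) (sym (coherent x k)) (mod< k (digit x (suc k)))

    digit-mod : (x : ℤ[ p ]) → ∀ {a b} → a ≤ b → digit x a ≡ digit x b mod[ p ^ a ]
    digit-mod x {a} {b} a≤b =
      subst (λ c → digit x a ≡ digit x c mod[ p ^ a ]) (m∸n+n≡m a≤b) (go (b ∸ a))
      where
      go : ∀ e → digit x a ≡ digit x (e + a) mod[ p ^ a ]
      go zero    = sym (mod-small a (digit< x a))
      go (suc e) = trans (go e) (trans (cong (_mod[ p ^ a ]) (coherent x (e + a)))
                                  (mod-mod (digit x (suc e + a)) (m≤n+m a e)))

    digit-≋ : (x : ℤ[ p ]) → ∀ {a b} → a ≤ b → digit x a ≋[ a ] digit x b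
    digit-≋ x {a} a≤b = trans (mod-small a (digit< x a)) (digit-mod x a≤b)

    residue : ℕ → ℤ[ p ]
    residue a = mkℤp (λ j → a mod[ p ^ j ]) (λ j → sym (mod-mod a (n≤1+n j)))

module DifferenceMethod where

  open FiniteDifference
  open PrimePowerDivisibility
  open import Data.Nat as ℕ using (ℕ; zero; suc; _!; _≤_; _<_; z≤n)
  import Data.Nat.Properties as ℕ
  import Data.Nat.Divisibility as ℕ
  open import Data.Nat.Primality using (Prime)
  open import Data.Integer using (ℤ; +_; _+_; _*_; 0ℤ; ∣_∣)
  open import Data.Integer.Properties hiding (_≟_)
  open import Data.Integer.Divisibility.Signed
  open import Data.Integer.Tactic.RingSolver using (solve-∀)
  open import Data.Fin as Fin using (Fin; toℕ)
  import Data.Fin.Properties as Fin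
  open import Algebra.Properties.Semiring.Sum +-*-semiring using (sum; sum-cong-≗; sum-remove; *-distribˡ-sum)
  open import Relation.Binary.PropositionalEquality
  open import Relation.Binary.Definitions using (tri<; tri≈; tri>)
  open import Relation.Nullary using (¬_)
  open import Data.Empty using (⊥-elim)

  sum-∣ : ∀ {M n} (a : Fin n → ℤ) → (∀ i → M ∣ a i) → M ∣ sum a
  sum-∣ {n = zero}  a M∣a = divides 0ℤ refl
  sum-∣ {n = suc n} a M∣a =
    ∣m∣n⇒∣m+n (M∣a Fin.zero) (sum-∣ (λ i → a (Fin.suc i)) (λ i → M∣a (Fin.suc i)))

  sum-∣-single : ∀ {M n} (a : Fin (suc n) → ℤ) j → M ∣ sum a → (∀ i → i ≢ j → M ∣ a i) → M ∣ a j
  sum-∣-single a j M∣sum M∣others = ∣m+n∣n⇒∣m (subst (_ ∣_) (sum-remove {i = j} a) M∣sum)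
    (sum-∣ _ (λ i → M∣others (Fin.punchIn j i) (Fin.punchInᵢ≢i j i)))

  module Difference (q : ℕ) (prime : Prime (suc (suc q))) where

    open PrimePower q prime

    private
      p : ℕ
      p = suc (suc q)

    P : ℕ → ℤ
    P e = + (p ℕ.^ e)

    P-+ : ∀ a b → P (a ℕ.+ b) ≡ P a * P b
    P-+ a b = trans (cong +_ (ℕ.^-distribˡ-+-* p a b)) (pos-* (p ℕ.^ a) (p ℕ.^ b))

    P-∣-* : ∀ a b {x y} → P a ∣ x → P b ∣ y → P (a ℕ.+ b) ∣ x * y
    P-∣-* a b (divides u refl) (divides v refl) =
      divides (u * v) (trans (reassoc u (P a) v (P b)) (cong ((u * v) *_) (sym (P-+ a b))))
      where
      reassoc : ∀ u a v b → (u * a) * (v * b) ≡ (u * v) * (a * b)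
      reassoc = solve-∀

    P-monoʳ-∣ : ∀ {a b} → a ≤ b → P a ∣ P b
    P-monoʳ-∣ a≤b = ∣ᵤ⇒∣ (^-monoʳ-∣ p a≤b)

    P-cancel : ∀ K e Y → P (K ℕ.+ e) ∣ P e * Y → P K ∣ Y
    P-cancel K e Y P[K+e]∣P[e]Y = ∣ᵤ⇒∣ (ℕ.*-cancelˡ-∣ (p ℕ.^ e) ⦃ ℕ.m^n≢0 p e ⦄
      (subst₂ ℕ._∣_ (trans (cong (p ℕ.^_) (ℕ.+-comm K e)) (ℕ.^-distribˡ-+-* p e K)) (abs-* (P e) Y)
        (∣⇒∣ᵤ P[K+e]∣P[e]Y)))

    P-cancel-∤ : ∀ β K {X c} → ¬ P β ∣ X → P K ∣ c * X → P K ∣ P β * c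
    P-cancel-∤ β K {X} {c} P[β]∤X P[K]∣cX = ∣ᵤ⇒∣ (subst (p ℕ.^ K ℕ.∣_) (sym (abs-* (P β) c))
      (^∣-cancel-^∤ {β} {∣ X ∣} {∣ c ∣} {K} (λ p^β∣X → P[β]∤X (∣ᵤ⇒∣ p^β∣X))
        (subst (p ℕ.^ K ℕ.∣_) (abs-* c X) (∣⇒∣ᵤ P[K]∣cX))))

    -- The (deg j)-th difference of Ψ at 0 kills the terms i < j; once p^k ∣ p^(mβ) cs i is
    -- known for i > j, those terms vanish modulo p^(k + S) too, leaving p^(w j + mβ) cs j
    -- (deg j)! (lead j).  This drives a downward induction on j; c is then read off from Ψ 0.
    module DifferenceArgument
      {r : ℕ} (T k β S : ℕ) (deg : Fin (suc r) → ℕ)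
      (deg-pos : ∀ i → 0 < deg i) (deg-mono : ∀ {i j} → i Fin.< j → deg i < deg j)
      (deg≤T : ∀ i → deg i ≤ T)
      (s w : Fin (suc r) → ℕ) (w+s≡S : ∀ i → w i ℕ.+ s i ≡ S)
      (H : Fin (suc r) → ℕ → ℤ) (lead : Fin (suc r) → ℤ)
      (H-poly : ∀ i → Poly (deg i) (lead i) (H i))
      (lead-∤ : ∀ i → ¬ P β ∣ + (deg i !) * lead i)
      (H-∣ : ∀ i t → t ≤ T → P (s i) ∣ H i t)
      (c : ℤ) (cs : Fin (suc r) → ℤ)
      (Ψ-∣ : ∀ t → t ≤ T → P (k ℕ.+ S) ∣ P S * c + sum (λ i → cs i * (P (w i) * H i t)))
      where

      Ψ : ℕ → ℤ
      Ψ t = P S * c + sum (λ i → cs i * (P (w i) * H i t))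

      Δ^-Ψ : ∀ N → 0 < N → ∀ t → Δ^ N Ψ t ≡ sum (λ i → cs i * (P (w i) * Δ^ N (H i) t))
      Δ^-Ψ (suc N) _ t = begin
        Δ^ (suc N) Ψ t
          ≡⟨ Δ^-+ (suc N) (λ _ → P S * c) (λ t → sum (λ i → cs i * (P (w i) * H i t))) t ⟩
        Δ^ (suc N) (λ _ → P S * c) t + Δ^ (suc N) (λ t → sum (λ i → cs i * (P (w i) * H i t))) t
          ≡⟨ cong₂ _+_ (Δ^-const N (P S * c) t) (Δ^-sum (suc N) (λ i t → cs i * (P (w i) * H i t)) t) ⟩
        0ℤ + sum (λ i → Δ^ (suc N) (λ t → cs i * (P (w i) * H i t)) t)
          ≡⟨ +-identityˡ _ ⟩
        sum (λ i → Δ^ (suc N) (λ t → cs i * (P (w i) * H i t)) t)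
          ≡⟨ sum-cong-≗ (λ i → trans (Δ^-*ˡ (suc N) (cs i) (λ t → P (w i) * H i t) t)
                                      (cong (cs i *_) (Δ^-*ˡ (suc N) (P (w i)) (H i) t))) ⟩
        sum (λ i → cs i * (P (w i) * Δ^ (suc N) (H i) t)) ∎
        where open ≡-Reasoning

      tail-∣ : ∀ W {x} i → P k ∣ P W * cs i → P (s i) ∣ x → P (k ℕ.+ S) ∣ P W * (cs i * (P (w i) * x))
      tail-∣ W {x} i P[k]∣ P[s]∣x = subst₂ _∣_ k+[w+s]≡k+S (reassoc (P W) (cs i) (P (w i)) x)
        (P-∣-* k (w i ℕ.+ s i) P[k]∣ (P-∣-* (w i) (s i) ∣-refl P[s]∣x))
        where
        k+[w+s]≡k+S : P (k ℕ.+ (w i ℕ.+ s i)) ≡ P (k ℕ.+ S)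
        k+[w+s]≡k+S = cong (λ e → P (k ℕ.+ e)) (w+s≡S i)
        reassoc : ∀ a c b x → (a * c) * (b * x) ≡ a * (c * (b * x))
        reassoc = solve-∀

      Δ^deg-∣ : ∀ j {M} φ → (∀ t → t ≤ T → M ∣ φ t) → M ∣ Δ^ (deg j) φ 0
      Δ^deg-∣ j φ M∣φ = Δ^-∣ _ (deg j) 0 φ
        (λ t t≤deg+0 → M∣φ t (ℕ.≤-trans t≤deg+0 (subst (_≤ T) (sym (ℕ.+-identityʳ (deg j))) (deg≤T j)))) 0 z≤n

      coefficient-∣-step : ∀ m j → (∀ i → j Fin.< i → P k ∣ P (m ℕ.* β) * cs i) → P k ∣ P (suc m ℕ.* β) * cs j
      coefficient-∣-step m j IH =
        subst (P k ∣_) P[β]*[P[W]*cs]≡ (P-cancel-∤ β k (lead-∤ j) (P-cancel k (w j) Y P[k+w]∣P[w]Y))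
        where
        N : ℕ
        N = deg j
        W : ℕ
        W = m ℕ.* β
        a : Fin (suc r) → ℤ
        a i = P W * (cs i * (P (w i) * Δ^ N (H i) 0))
        Y : ℤ
        Y = (P W * cs j) * (+ (N !) * lead j)
        ∣sum : P (k ℕ.+ S) ∣ sum a
        ∣sum = subst (P (k ℕ.+ S) ∣_)
                 (trans (cong (P W *_) (Δ^-Ψ N (deg-pos j) 0))
                        (*-distribˡ-sum (P W) (λ i → cs i * (P (w i) * Δ^ N (H i) 0))))
                 (∣n⇒∣m*n (P W) (Δ^deg-∣ j Ψ Ψ-∣))
        ∣others : ∀ i → i ≢ j → P (k ℕ.+ S) ∣ a i
        ∣others i i≢j with Fin.<-cmp i j
        ... | tri< i<j _ _ = ∣n⇒∣m*n (P W) (∣n⇒∣m*n (cs i) (∣n⇒∣m*n (P (w i))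
                                (subst (_ ∣_) (sym (Δ^-vanish (deg i) N (deg-mono i<j) (H-poly i) 0)) (divides 0ℤ refl))))
        ... | tri≈ _ i≡j _ = ⊥-elim (i≢j i≡j)
        ... | tri> _ _ j<i = tail-∣ W i (IH i j<i) (Δ^deg-∣ j (H i) (H-∣ i))
        a[j]≡ : a j ≡ P (w j) * Y
        a[j]≡ = trans (cong (λ z → P W * (cs j * (P (w j) * z))) (Δ^-top N (H-poly j) 0))
                      (reassoc (P W) (cs j) (P (w j)) (+ (N !) * lead j))
          where
          reassoc : ∀ a c b x → a * (c * (b * x)) ≡ b * ((a * c) * x)
          reassoc = solve-∀
        w≤S : w j ≤ S
        w≤S = subst (w j ≤_) (w+s≡S j) (ℕ.m≤m+n (w j) (s j))
        P[k+w]∣P[w]Y : P (k ℕ.+ w j) ∣ P (w j) * Y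
        P[k+w]∣P[w]Y = ∣-trans (P-monoʳ-∣ (ℕ.+-monoʳ-≤ k w≤S))
                         (subst (_ ∣_) a[j]≡ (sum-∣-single a j ∣sum ∣others))
        P[β]*[P[W]*cs]≡ : P β * (P W * cs j) ≡ P (suc m ℕ.* β) * cs j
        P[β]*[P[W]*cs]≡ = trans (sym (*-assoc (P β) (P W) (cs j))) (cong (_* cs j) (sym (P-+ β W)))

      coefficient-∣-descending : ∀ m i → suc r ≤ toℕ i ℕ.+ m → P k ∣ P (m ℕ.* β) * cs i
      coefficient-∣-descending zero    i r<i+0 =
        ⊥-elim (ℕ.<⇒≱ (Fin.toℕ<n i) (subst (suc r ≤_) (ℕ.+-identityʳ (toℕ i)) r<i+0))
      coefficient-∣-descending (suc m) i r<i+m+1 = coefficient-∣-step m i λ j i<j →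
        coefficient-∣-descending m j
          (ℕ.≤-trans r<i+m+1 (subst (_≤ toℕ j ℕ.+ m) (sym (ℕ.+-suc (toℕ i) m)) (ℕ.+-monoˡ-≤ m i<j)))

      coefficient-∣ : ∀ i → P k ∣ P (suc r ℕ.* β) * cs i
      coefficient-∣ i = coefficient-∣-descending (suc r) i (ℕ.m≤n+m (suc r) (toℕ i))

      constant-∣ : P k ∣ P (suc r ℕ.* β) * c
      constant-∣ = P-cancel k S (P W * c) (subst (P (k ℕ.+ S) ∣_) (swap (P W) (P S) c)
        (∣m+n∣n⇒∣m (subst (P (k ℕ.+ S) ∣_) expand (∣n⇒∣m*n (P W) (Ψ-∣ 0 z≤n)))
                    (sum-∣ _ λ i → tail-∣ W i (coefficient-∣ i) (H-∣ i 0 z≤n))))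
        where
        W : ℕ
        W = suc r ℕ.* β
        swap : ∀ w s c → w * (s * c) ≡ s * (w * c)
        swap = solve-∀
        expand : P W * Ψ 0 ≡ P W * (P S * c) + sum (λ i → P W * (cs i * (P (w i) * H i 0)))
        expand = trans (*-distribˡ-+ (P W) (P S * c) _)
                   (cong (λ z → P W * (P S * c) + z) (*-distribˡ-sum (P W) (λ i → cs i * (P (w i) * H i 0))))

module Iterates where

  open Residues
  open import Data.Nat
  open import Data.Nat.Properties
  open import Data.Nat.DivMod using (m/n*n≡m)
  open import Data.Nat.Divisibility using (_∣_; m%n≡0⇒n∣m)
  open import Data.Nat.Tactic.RingSolver using (solve-∀)
  open import Data.Fin as Fin using (Fin; toℕ)
  import Data.Fin.Properties as Fin
  open import Data.Vec using (tabulate; sum; lookup)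
  open import Data.Product using (∃; _×_; _,_)
  open import Relation.Binary.PropositionalEquality
  open import Function using (_∘_)
  open import Data.Sum using (inj₁; inj₂)

  sum-tabulate-cong : ∀ {n} (h h′ : Fin n → ℕ) → (∀ j → h j ≡ h′ j) → sum (tabulate h) ≡ sum (tabulate h′)
  sum-tabulate-cong {zero}  h h′ h≡h′ = refl
  sum-tabulate-cong {suc n} h h′ h≡h′ =
    cong₂ _+_ (h≡h′ Fin.zero) (sum-tabulate-cong (h ∘ Fin.suc) (h′ ∘ Fin.suc) (h≡h′ ∘ Fin.suc))

  sum-tabulate-*ˡ : ∀ {n} c (h : Fin n → ℕ) → sum (tabulate (λ j → c * h j)) ≡ c * sum (tabulate h)
  sum-tabulate-*ˡ {zero}  c h = sym (*-zeroʳ c)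
  sum-tabulate-*ˡ {suc n} c h =
    trans (cong (c * h Fin.zero +_) (sum-tabulate-*ˡ c (h ∘ Fin.suc))) (sym (*-distribˡ-+ c (h Fin.zero) _))

  ^-distribʳ-* : ∀ x y j → (x * y) ^ j ≡ x ^ j * y ^ j
  ^-distribʳ-* x y zero    = refl
  ^-distribʳ-* x y (suc j) = trans (cong (x * y *_) (^-distribʳ-* x y j)) (reassoc x y (x ^ j) (y ^ j))
    where
    reassoc : ∀ x y u v → x * y * (u * v) ≡ x * u * (y * v)
    reassoc = solve-∀

  module Iteration (q : ℕ) {d : ℕ} (f : QpPoly (suc (suc q)) d) where

    open Residue q

    private
      p : ℕ
      p = suc (suc q)

    m : ℕ
    m = denExp f

    coeff : ℕ → Fin (suc d) → ℕ
    coeff L j = digit (lookup (numer f) j) L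

    numerator : ℕ → ℕ → ℕ
    numerator L y = sum (tabulate λ j → coeff L j * y ^ toℕ j)

    numerator-≋ : ∀ {a L L′ y y′} → a ≤ L → a ≤ L′ → y ≋[ a ] y′ → numerator L y ≋[ a ] numerator L′ y′
    numerator-≋ {a} a≤L a≤L′ y≋y′ = ≋-sum a _ _ λ j →
      ≋-* a (trans (sym (digit-mod (lookup (numer f) j) a≤L)) (digit-mod (lookup (numer f) j) a≤L′))
              (≋-^ a y≋y′ (toℕ j))

    fval-coherent : (x : ℕ → ℕ) → (∀ k → x k ≡ x (suc k) mod[ p ^ k ]) →
                    ∀ k → fval f x k ≡ fval f x (suc k) mod[ p ^ k ]
    fval-coherent x x-coh k = sym (begin
      fval f x (suc k) mod[ p ^ k ]
        ≡⟨ sym (mod-div k m A) ⟩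
      (A mod[ p ^ (k + m) ]) div[ p ^ m ]
        ≡⟨ cong (_div[ p ^ m ]) (mod-mod (numerator (suc k + m) (x (suc k + m))) (n≤1+n (k + m))) ⟩
      (numerator (suc k + m) (x (suc k + m)) mod[ p ^ (k + m) ]) div[ p ^ m ]
        ≡⟨ cong (_div[ p ^ m ]) (sym (numerator-≋ ≤-refl (n≤1+n (k + m))
             (digit-≋ (mkℤp x x-coh) (n≤1+n (k + m))))) ⟩
      fval f x k ∎)
      where
      open ≡-Reasoning
      A : ℕ
      A = numerator (suc k + m) (x (suc k + m)) mod[ p ^ (suc k + m) ]

    orbit-coherent : (x₀ : ℤ[ p ]) → ∀ n k → orbit f x₀ n k ≡ orbit f x₀ n (suc k) mod[ p ^ k ]
    orbit-coherent x₀ zero    = coherent x₀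
    orbit-coherent x₀ (suc n) = fval-coherent (orbit f x₀ n) (orbit-coherent x₀ n)

    orbitℤ[p] : ℤ[ p ] → ℕ → ℤ[ p ]
    orbitℤ[p] x₀ n = mkℤp (orbit f x₀ n) (orbit-coherent x₀ n)

    orbit-iter : Compatible f → (x₀ : ℤ[ p ]) → ∀ k n → orbit f x₀ n k ≡ iter (inducedMod f k) n (digit x₀ k)
    orbit-iter compatible x₀ k zero    = refl
    orbit-iter compatible x₀ k (suc n) =
      trans (compatible (orbitℤ[p] x₀ n) (residue (orbit f x₀ n k)) k
                        (sym (mod-small k (digit< (orbitℤ[p] x₀ n) k))))
            (cong (inducedMod f k) (orbit-iter compatible x₀ k n))

    orbit-surjective : Compatible f → Ergodic f → (x₀ : ℤ[ p ]) → ∀ k → 1 ≤ k →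
                       ∀ t → t < p ^ k → ∃ λ n → orbit f x₀ n k ≡ t
    orbit-surjective compatible ergodic x₀ k 1≤k t t<p^k
      with ergodic k 1≤k (digit x₀ k) t (digit< x₀ k) t<p^k
    ... | n , iterₙ≡t = n , trans (orbit-iter compatible x₀ k n) iterₙ≡t

    numerator-factor : IntegerValued f → ∀ {k L} → k + m ≤ L →
                       ∀ a → ∃ λ a′ → numerator L a ≡ p ^ m * a′ × a′ mod[ p ^ k ] ≡ inducedMod f k a
    numerator-factor integer-valued {k} {L} k+m≤L a = a′ , N≡p^m*a′ , sym fval≡a′
      where
      N : ℕ
      N = numerator L a
      p^m∣N : p ^ m ∣ N
      p^m∣N = m%n≡0⇒n∣m N (p ^ m) ⦃ p^≢0 m ⦄
        (trans (numerator-≋ (≤-trans (m≤n+m m k) k+m≤L) ≤-refl (sym (mod-≋ m a))) (integer-valued (residue a)))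
      a′ : ℕ
      a′ = N div[ p ^ m ]
      N≡p^m*a′ : N ≡ p ^ m * a′
      N≡p^m*a′ = trans (sym (m/n*n≡m ⦃ p^≢0 m ⦄ p^m∣N)) (*-comm a′ (p ^ m))
      fval≡a′ : inducedMod f k a ≡ a′ mod[ p ^ k ]
      fval≡a′ = trans (cong (_div[ p ^ m ]) (numerator-≋ ≤-refl k+m≤L (mod-≋ (k + m) a)))
                  (trans (cong (λ x → (x mod[ p ^ (k + m) ]) div[ p ^ m ]) N≡p^m*a′) (*-mod-div k m a′))

    module Rescaled (L : ℕ) where

      S : ℕ → ℕ
      S zero    = 0
      S (suc i) = suc (d * S i)

      s : ℕ → ℕ
      s i = m * S i

      S-≤-suc : ∀ i → S i ≤ S (suc i)
      S-≤-suc zero    = z≤n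
      S-≤-suc (suc i) = s≤s (*-monoʳ-≤ d (S-≤-suc i))

      s-mono : ∀ {i j} → i ≤ j → s i ≤ s j
      s-mono {i} {zero}  z≤n     = ≤-refl
      s-mono {i} {suc j} i≤j+1 with m≤n⇒m<n∨m≡n i≤j+1
      ... | inj₁ i<j+1 = ≤-trans (s-mono (≤-pred i<j+1)) (*-monoʳ-≤ m (S-≤-suc j))
      ... | inj₂ refl  = ≤-refl

      -- H (1 + i) = p^(d · s i) g(H i / p^(s i)), with g read modulo p^L: an integer polynomial.
      H : ℕ → ℕ → ℕ
      H zero    t = t
      H (suc i) t = sum (tabulate λ j → coeff L j * p ^ (s i * (d ∸ toℕ j)) * H i t ^ toℕ j)

      H-rescale : ∀ e a → sum (tabulate λ j → coeff L j * p ^ (e * (d ∸ toℕ j)) * (p ^ e * a) ^ toℕ j)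
                          ≡ p ^ (e * d) * numerator L a
      H-rescale e a = trans (sum-tabulate-cong _ _ term) (sum-tabulate-*ˡ (p ^ (e * d)) (λ j → coeff L j * a ^ toℕ j))
        where
        reassoc : ∀ g u v w → g * u * (v * w) ≡ u * v * (g * w)
        reassoc = solve-∀
        term : ∀ j → coeff L j * p ^ (e * (d ∸ toℕ j)) * (p ^ e * a) ^ toℕ j ≡ p ^ (e * d) * (coeff L j * a ^ toℕ j)
        term j = begin
          coeff L j * p ^ (e * (d ∸ toℕ j)) * (p ^ e * a) ^ toℕ j
            ≡⟨ cong (coeff L j * p ^ (e * (d ∸ toℕ j)) *_)
                 (trans (^-distribʳ-* (p ^ e) a (toℕ j)) (cong (_* a ^ toℕ j) (^-*-assoc p e (toℕ j)))) ⟩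
          coeff L j * p ^ (e * (d ∸ toℕ j)) * (p ^ (e * toℕ j) * a ^ toℕ j)
            ≡⟨ reassoc (coeff L j) (p ^ (e * (d ∸ toℕ j))) (p ^ (e * toℕ j)) (a ^ toℕ j) ⟩
          p ^ (e * (d ∸ toℕ j)) * p ^ (e * toℕ j) * (coeff L j * a ^ toℕ j)
            ≡⟨ cong (_* (coeff L j * a ^ toℕ j)) (sym (^-distribˡ-+-* p (e * (d ∸ toℕ j)) (e * toℕ j))) ⟩
          p ^ (e * (d ∸ toℕ j) + e * toℕ j) * (coeff L j * a ^ toℕ j)
            ≡⟨ cong (λ x → p ^ x * (coeff L j * a ^ toℕ j))
                 (trans (sym (*-distribˡ-+ e (d ∸ toℕ j) (toℕ j)))
                        (cong (e *_) (m∸n+n≡m (≤-pred (Fin.toℕ<n j))))) ⟩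
          p ^ (e * d) * (coeff L j * a ^ toℕ j) ∎
          where open ≡-Reasoning

      module _ (compatible : Compatible f) (integer-valued : IntegerValued f)
               (x₀ : ℤ[ p ]) {k : ℕ} (k+m≤L : k + m ≤ L) where

        rescaled-orbit : ∀ n i → ∃ λ A → H i (orbit f x₀ n k) ≡ p ^ s i * A
                                         × A mod[ p ^ k ] ≡ orbit f x₀ (n + i) k
        rescaled-orbit n zero = orbit f x₀ n k , sym p^0*t≡t ,
          trans (mod-small k (digit< (orbitℤ[p] x₀ n) k)) (cong (λ j → orbit f x₀ j k) (sym (+-identityʳ n)))
          where
          p^0*t≡t : p ^ s 0 * orbit f x₀ n k ≡ orbit f x₀ n k
          p^0*t≡t = trans (cong (λ e → p ^ e * orbit f x₀ n k) (*-zeroʳ m)) (+-identityʳ _)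
        rescaled-orbit n (suc i) with rescaled-orbit n i
        ... | A , H≡p^s*A , A≡orbit with numerator-factor integer-valued k+m≤L A
        ... | A′ , N≡p^m*A′ , A′≡f[A] = A′ , H≡p^s*A′ , A′≡orbit
          where
          t : ℕ
          t = orbit f x₀ n k
          exponent : ∀ m S d → m * S * d + m ≡ m * suc (d * S)
          exponent = solve-∀
          H≡p^s*A′ : H (suc i) t ≡ p ^ s (suc i) * A′
          H≡p^s*A′ = begin
            H (suc i) t
              ≡⟨ sum-tabulate-cong _ _
                   (λ j → cong (λ x → coeff L j * p ^ (s i * (d ∸ toℕ j)) * x ^ toℕ j) H≡p^s*A) ⟩
            sum (tabulate λ j → coeff L j * p ^ (s i * (d ∸ toℕ j)) * (p ^ s i * A) ^ toℕ j)
              ≡⟨ H-rescale (s i) A ⟩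
            p ^ (s i * d) * numerator L A
              ≡⟨ cong (p ^ (s i * d) *_) N≡p^m*A′ ⟩
            p ^ (s i * d) * (p ^ m * A′)
              ≡⟨ sym (*-assoc (p ^ (s i * d)) (p ^ m) A′) ⟩
            p ^ (s i * d) * p ^ m * A′
              ≡⟨ cong (_* A′) (trans (sym (^-distribˡ-+-* p (s i * d) m)) (cong (p ^_) (exponent m (S i) d))) ⟩
            p ^ s (suc i) * A′ ∎
            where open ≡-Reasoning
          A′≡orbit : A′ mod[ p ^ k ] ≡ orbit f x₀ (n + suc i) k
          A′≡orbit = trans A′≡f[A]
            (trans (sym (compatible (orbitℤ[p] x₀ (n + i)) (residue A) k (sym A≡orbit)))
                   (cong (λ j → orbit f x₀ j k) (sym (+-suc n i))))

module LeadingTerms where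

  open FiniteDifference
  open PrimePowerDivisibility
  open Iterates
  open import Data.Nat as ℕ using (ℕ; zero; suc; _!; _≤_; _<_; NonZero)
  import Data.Nat.Properties as ℕ
  open import Data.Nat.Divisibility using (_∣_)
  open import Data.Nat.Primality using (Prime)
  open import Data.Integer using (ℤ; +_; _+_; _*_; _^_; 0ℤ)
  open import Data.Integer.Properties using (pos-+; pos-*; +-*-semiring; +-identityˡ)
  open import Data.Fin as Fin using (Fin; toℕ; fromℕ; inject₁)
  import Data.Fin.Properties as Fin
  import Data.Vec as Vec
  open import Algebra.Properties.Semiring.Sum +-*-semiring using (sum; sum-init-last; sum-replicate-zero)
  open import Relation.Binary.PropositionalEquality
  open import Relation.Nullary using (¬_)
  open import Function using (_∘_)

  pos-^ : ∀ a j → + (a ℕ.^ j) ≡ (+ a) ^ j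
  pos-^ a zero    = refl
  pos-^ a (suc j) = trans (pos-* a (a ℕ.^ j)) (cong (+ a *_) (pos-^ a j))

  pos-sum : ∀ {n} (h : Fin n → ℕ) → + Vec.sum (Vec.tabulate h) ≡ sum (λ j → + h j)
  pos-sum {zero}  h = refl
  pos-sum {suc n} h = trans (pos-+ (h Fin.zero) _) (cong (λ x → + h Fin.zero + x) (pos-sum (h ∘ Fin.suc)))

  lead-exponent : ℕ → ℕ → ℕ → ℕ
  lead-exponent d e zero    = 1
  lead-exponent d e (suc i) = e ℕ.+ suc (d ℕ.* lead-exponent d e i)

  module LeadingTerm (q : ℕ) {d : ℕ} .⦃ d≢0 : NonZero d ⦄ (f : QpPoly (suc (suc q)) d) (L : ℕ) where

    open Iteration q f
    open Rescaled L

    private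
      p : ℕ
      p = suc (suc q)

    lead : ℕ → ℕ
    lead zero    = 1
    lead (suc i) = coeff L (fromℕ d) ℕ.* lead i ℕ.^ d

    monomial : ℕ → Fin (suc d) → ℕ → ℤ
    monomial i j t = + (coeff L j ℕ.* p ℕ.^ (s i ℕ.* (d ℕ.∸ toℕ j)) ℕ.* H i t ℕ.^ toℕ j)

    H-suc-split : ∀ i t → + H (suc i) t ≡ sum (λ j → monomial i (inject₁ j) t) + monomial i (fromℕ d) t
    H-suc-split i t =
      trans (pos-sum (λ j → coeff L j ℕ.* p ℕ.^ (s i ℕ.* (d ℕ.∸ toℕ j)) ℕ.* H i t ℕ.^ toℕ j))
            (sum-init-last (λ j → monomial i j t))

    monomial-poly : ∀ i → Poly (d ℕ.^ i) (+ lead i) (λ t → + H i t) → ∀ j e → toℕ j ≡ e →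
                    Poly (e ℕ.* d ℕ.^ i) (+ (coeff L j ℕ.* p ℕ.^ (s i ℕ.* (d ℕ.∸ e))) * (+ lead i) ^ e) (monomial i j)
    monomial-poly i H-poly j .(toℕ j) refl = Poly-cong (toℕ j ℕ.* d ℕ.^ i)
      (λ t → trans (cong (+ c *_) (sym (pos-^ (H i t) (toℕ j)))) (sym (pos-* c (H i t ℕ.^ toℕ j))))
      (Poly-*ˡ (toℕ j ℕ.* d ℕ.^ i) (+ c) (Poly-^ (d ℕ.^ i) H-poly (toℕ j)))
      where
      c : ℕ
      c = coeff L j ℕ.* p ℕ.^ (s i ℕ.* (d ℕ.∸ toℕ j))

    top-coefficient : ℕ → ℤ
    top-coefficient i = + (coeff L (fromℕ d) ℕ.* p ℕ.^ (s i ℕ.* (d ℕ.∸ d))) * (+ lead i) ^ d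

    top-coefficient≡lead : ∀ i → top-coefficient i ≡ + lead (suc i)
    top-coefficient≡lead i = begin
      + (γ ℕ.* p ℕ.^ (s i ℕ.* (d ℕ.∸ d))) * (+ lead i) ^ d
        ≡⟨ cong (λ e → + (γ ℕ.* p ℕ.^ e) * (+ lead i) ^ d)
             (trans (cong (s i ℕ.*_) (ℕ.n∸n≡0 d)) (ℕ.*-zeroʳ (s i))) ⟩
      + (γ ℕ.* 1) * (+ lead i) ^ d
        ≡⟨ cong (λ x → + x * (+ lead i) ^ d) (ℕ.*-identityʳ γ) ⟩
      + γ * (+ lead i) ^ d
        ≡⟨ trans (cong (+ γ *_) (sym (pos-^ (lead i) d))) (sym (pos-* γ (lead i ℕ.^ d))) ⟩
      + lead (suc i) ∎
      where
      open ≡-Reasoning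
      γ : ℕ
      γ = coeff L (fromℕ d)

    H-poly : ∀ i → Poly (d ℕ.^ i) (+ lead i) (λ t → + H i t)
    H-poly zero    = Poly-id
    H-poly (suc i) = Poly-cong (d ℕ.^ suc i) (sym ∘ H-suc-split i)
      (Poly-resp-lead (d ℕ.^ suc i) lead≡ (Poly-+ (d ℕ.^ suc i) low top))
      where
      low-degree : ∀ j → toℕ (inject₁ j) ℕ.* d ℕ.^ i < d ℕ.^ suc i
      low-degree j =
        ℕ.*-monoˡ-< (d ℕ.^ i) ⦃ ℕ.m^n≢0 d i ⦄ (subst (ℕ._< d) (sym (Fin.toℕ-inject₁ j)) (Fin.toℕ<n j))
      low : Poly (d ℕ.^ suc i) (sum (λ (_ : Fin d) → 0ℤ)) (λ t → sum (λ j → monomial i (inject₁ j) t))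
      low = Poly-sum (d ℕ.^ suc i) λ j →
        Poly-lift< _ (d ℕ.^ suc i) (low-degree j) (monomial-poly i (H-poly i) (inject₁ j) (toℕ (inject₁ j)) refl)
      top : Poly (d ℕ.^ suc i) (top-coefficient i) (monomial i (fromℕ d))
      top = monomial-poly i (H-poly i) (fromℕ d) d (Fin.toℕ-fromℕ d)
      lead≡ : sum (λ (_ : Fin d) → 0ℤ) + top-coefficient i ≡ + lead (suc i)
      lead≡ = trans (cong (_+ top-coefficient i) (sum-replicate-zero d))
                    (trans (+-identityˡ (top-coefficient i)) (top-coefficient≡lead i))

    module _ (prime : Prime p) {e : ℕ} (p^e∤lc : ¬ p ℕ.^ e ∣ coeff L (fromℕ d)) where

      open PrimePower q prime

      lead-∤ : ∀ i → ¬ p ℕ.^ lead-exponent d e i ∣ lead i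
      lead-∤ zero    = p^n∤n 1 (ℕ.s≤s ℕ.z≤n)
      lead-∤ (suc i) = ^∤-* e _ p^e∤lc (^∤-^ (lead-exponent d e i) (lead-∤ i) d)

      !*lead-∤ : ∀ i → ¬ p ℕ.^ ((d ℕ.^ i) ! ℕ.+ lead-exponent d e i) ∣ (d ℕ.^ i) ! ℕ.* lead i
      !*lead-∤ i = ^∤-* ((d ℕ.^ i) !) _ (p^n∤n ((d ℕ.^ i) !) (ℕ.1≤n! (d ℕ.^ i))) (lead-∤ i)

module LinearRecurrence where

  open FiniteDifference
  open PrimePowerDivisibility
  open Residues
  open DifferenceMethod
  open Iterates
  open LeadingTerms
  open import Data.Nat as ℕ using (ℕ; zero; suc; _!; _≤_; _<_; z≤n; s≤s)
  import Data.Nat.Properties as ℕ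
  import Data.Nat.Divisibility as ℕ
  import Data.Nat.DivMod as ℕ
  open import Data.Nat.Primality using (Prime)
  open import Data.Integer using (ℤ; +_; _+_; _-_; _*_)
  import Data.Integer as ℤ
  import Data.Integer.Properties as ℤ
  open import Data.Integer.Properties using (pos-+; pos-*; +-*-semiring)
  open import Data.Integer.Divisibility.Signed
  open import Data.Integer.Tactic.RingSolver using (solve-∀)
  open import Data.Fin as Fin using (Fin; toℕ; fromℕ)
  import Data.Fin.Properties as Fin
  open import Data.Vec using (Vec; lookup; tabulate)
  import Data.Vec as Vec
  open import Algebra.Properties.Semiring.Sum +-*-semiring using (sum; sum-cong-≗; *-distribˡ-sum; ∑-distrib-+)
  open import Data.Product using (∃; _,_; proj₁; proj₂)
  open import Relation.Binary.PropositionalEquality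
  open import Relation.Nullary using (¬_)
  open import Data.Empty using (⊥)

  module Recurrence
    (q : ℕ) (prime : Prime (suc (suc q))) {d : ℕ} (1<d : 1 < d) (f : QpPoly (suc (suc q)) d)
    (integer-valued : IntegerValued f) (compatible : Compatible f) (ergodic : Ergodic f)
    (x₀ : ℤ[ suc (suc q) ]) (r : ℕ) (recurrence : LinearRecurrenceModAll f x₀ r)
    {e : ℕ} (lc≢0 : ¬ digit (lookup (numer f) (fromℕ d)) e ≡ 0)
    where

    private
      p : ℕ
      p = suc (suc q)

    instance
      d≢0 : ℕ.NonZero d
      d≢0 = ℕ.>-nonZero (ℕ.<-trans (s≤s z≤n) 1<d)

    open Residue q
    open PrimePower q prime
    open Difference q prime
    open Iteration q f

    -- k exceeds T, so that every t ≤ T is a residue mod p^k visited by the orbit, and W, so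
    -- that p^k ∣ p^W x forces p ∣ x; modulo p^L, g determines f modulo p^k and keeps its
    -- leading coefficient nonzero.
    T : ℕ
    T = d ℕ.^ r

    β : ℕ
    β = cumulative (λ i → (d ℕ.^ i) ! ℕ.+ lead-exponent d e i) r

    W : ℕ
    W = suc r ℕ.* β

    k : ℕ
    k = suc (W ℕ.+ T)

    L : ℕ
    L = k ℕ.+ m ℕ.+ e

    open Rescaled L
    open LeadingTerm q f L

    p^e∤lc : ¬ p ℕ.^ e ℕ.∣ coeff L (fromℕ d)
    p^e∤lc p^e∣lc = lc≢0 (trans (digit-mod (lookup (numer f) (fromℕ d)) (ℕ.m≤n+m e (k ℕ.+ m)))
                                (ℕ.n∣m⇒m%n≡0 _ (p ℕ.^ e) ⦃ p^≢0 e ⦄ p^e∣lc))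

    orbit-covers : ∀ t → t ≤ T → ∃ λ n → orbit f x₀ n k ≡ t
    orbit-covers t t≤T = orbit-surjective compatible ergodic x₀ k (s≤s z≤n) t
      (ℕ.≤-<-trans t≤T (ℕ.<-trans (s≤s (ℕ.m≤n+m T W)) (n<p^n k)))

    cₚ : ℤ[ p ]
    cₚ = proj₁ (recurrence k)

    csₚ : Vec ℤ[ p ] (suc r)
    csₚ = proj₁ (proj₂ (recurrence k))

    c : ℤ
    c = + digit cₚ k

    cs : Fin (suc r) → ℤ
    cs i = + digit (lookup csₚ i) k

    relation-∣ : ∀ n → P k ∣ c + sum (λ i → cs i * + orbit f x₀ (n ℕ.+ toℕ i) k)
    relation-∣ n = subst (P k ∣_) cast
      (∣ᵤ⇒∣ (ℕ.m%n≡0⇒n∣m _ (p ℕ.^ k) ⦃ p^≢0 k ⦄ (proj₂ (proj₂ (proj₂ (recurrence k))) n)))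
      where
      h : Fin (suc r) → ℕ
      h i = digit (lookup csₚ i) k ℕ.* orbit f x₀ (n ℕ.+ toℕ i) k
      cast : + (digit cₚ k ℕ.+ Vec.sum (tabulate h)) ≡ c + sum (λ i → cs i * + orbit f x₀ (n ℕ.+ toℕ i) k)
      cast = trans (pos-+ (digit cₚ k) _) (cong (λ x → c + x)
               (trans (pos-sum h) (sum-cong-≗ λ i → pos-* (digit (lookup csₚ i) k) (orbit f x₀ (n ℕ.+ toℕ i) k))))

    mod-∣ : ∀ a → P k ∣ + a - + (a mod[ p ^ k ])
    mod-∣ a = divides (+ (a div[ p ^ k ])) (begin
      + a - + (a mod[ p ^ k ])
        ≡⟨ cong (λ x → + x - + (a mod[ p ^ k ])) (ℕ.m≡m%n+[m/n]*n a (p ℕ.^ k) ⦃ p^≢0 k ⦄) ⟩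
      + (a mod[ p ^ k ] ℕ.+ a div[ p ^ k ] ℕ.* p ℕ.^ k) - + (a mod[ p ^ k ])
        ≡⟨ cong (_- + (a mod[ p ^ k ])) (trans (pos-+ (a mod[ p ^ k ]) _)
             (cong (λ x → + (a mod[ p ^ k ]) + x) (pos-* (a div[ p ^ k ]) (p ℕ.^ k)))) ⟩
      (+ (a mod[ p ^ k ]) + + (a div[ p ^ k ]) * P k) - + (a mod[ p ^ k ])
        ≡⟨ cancel (+ (a mod[ p ^ k ])) (+ (a div[ p ^ k ]) * P k) ⟩
      + (a div[ p ^ k ]) * P k ∎)
      where
      open ≡-Reasoning
      cancel : ∀ x y → (x + y) - x ≡ y
      cancel = solve-∀

    k+m≤L : k ℕ.+ m ≤ L
    k+m≤L = ℕ.m≤m+n (k ℕ.+ m) e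

    A : ℕ → ℕ → ℕ
    A n i = proj₁ (rescaled-orbit compatible integer-valued x₀ k+m≤L n i)

    H≡p^s*A : ∀ n i → H i (orbit f x₀ n k) ≡ p ℕ.^ s i ℕ.* A n i
    H≡p^s*A n i = proj₁ (proj₂ (rescaled-orbit compatible integer-valued x₀ k+m≤L n i))

    A≋orbit : ∀ n i → A n i mod[ p ^ k ] ≡ orbit f x₀ (n ℕ.+ i) k
    A≋orbit n i = proj₂ (proj₂ (rescaled-orbit compatible integer-valued x₀ k+m≤L n i))

    H-∣ : ∀ i t → t ≤ T → P (s i) ∣ + H i t
    H-∣ i t t≤T with orbit-covers t t≤T
    ... | n , refl = divides (+ A n i)
      (trans (cong +_ (H≡p^s*A n i)) (trans (pos-* (p ℕ.^ s i) (A n i)) (ℤ.*-comm (P (s i)) (+ A n i))))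

    combination-∣ : ∀ n → P k ∣ c + sum (λ i → cs i * + A n (toℕ i))
    combination-∣ n = subst (P k ∣_) (sym split) (∣m∣n⇒∣m+n (relation-∣ n)
      (sum-∣ _ λ i → ∣n⇒∣m*n (cs i)
        (subst (λ x → P k ∣ + A n (toℕ i) - + x) (A≋orbit n (toℕ i)) (mod-∣ (A n (toℕ i))))))
      where
      a o : Fin (suc r) → ℤ
      a i = + A n (toℕ i)
      o i = + orbit f x₀ (n ℕ.+ toℕ i) k
      add-sub : ∀ c a b → c * a ≡ c * b + c * (a - b)
      add-sub = solve-∀
      split : c + sum (λ i → cs i * a i) ≡ (c + sum (λ i → cs i * o i)) + sum (λ i → cs i * (a i - o i))
      split = trans (cong (λ x → c + x) (trans (sum-cong-≗ λ i → add-sub (cs i) (a i) (o i))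
                                               (∑-distrib-+ (λ i → cs i * o i) (λ i → cs i * (a i - o i)))))
                    (sym (ℤ.+-assoc c (sum (λ i → cs i * o i)) (sum (λ i → cs i * (a i - o i)))))

    sᵣ : ℕ
    sᵣ = s r

    w : Fin (suc r) → ℕ
    w i = sᵣ ℕ.∸ s (toℕ i)

    w+s≡sᵣ : ∀ i → w i ℕ.+ s (toℕ i) ≡ sᵣ
    w+s≡sᵣ i = ℕ.m∸n+n≡m (s-mono (ℕ.≤-pred (Fin.toℕ<n i)))

    Ψ-orbit : ∀ n → P sᵣ * c + sum (λ i → cs i * (P (w i) * + H (toℕ i) (orbit f x₀ n k)))
                    ≡ P sᵣ * (c + sum (λ i → cs i * + A n (toℕ i)))
    Ψ-orbit n = sym (trans (ℤ.*-distribˡ-+ (P sᵣ) c _)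
      (cong (λ x → P sᵣ * c + x)
        (trans (*-distribˡ-sum (P sᵣ) (λ i → cs i * + A n (toℕ i))) (sum-cong-≗ term))))
      where
      term : ∀ i → P sᵣ * (cs i * + A n (toℕ i)) ≡ cs i * (P (w i) * + H (toℕ i) (orbit f x₀ n k))
      term i = begin
        P sᵣ * (cs i * + A n (toℕ i))
          ≡⟨ cong (λ x → x * (cs i * + A n (toℕ i)))
               (trans (cong P (sym (w+s≡sᵣ i))) (P-+ (w i) (s (toℕ i)))) ⟩
        (P (w i) * P (s (toℕ i))) * (cs i * + A n (toℕ i))
          ≡⟨ reorder (P (w i)) (P (s (toℕ i))) (cs i) (+ A n (toℕ i)) ⟩
        cs i * (P (w i) * (P (s (toℕ i)) * + A n (toℕ i)))
          ≡⟨ cong (λ x → cs i * (P (w i) * x))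
               (sym (trans (cong +_ (H≡p^s*A n (toℕ i))) (pos-* (p ℕ.^ s (toℕ i)) (A n (toℕ i))))) ⟩
        cs i * (P (w i) * + H (toℕ i) (orbit f x₀ n k)) ∎
        where
        open ≡-Reasoning
        reorder : ∀ a b c x → (a * b) * (c * x) ≡ c * (a * (b * x))
        reorder = solve-∀

    Ψ-∣ : ∀ t → t ≤ T → P (k ℕ.+ sᵣ) ∣ P sᵣ * c + sum (λ i → cs i * (P (w i) * + H (toℕ i) t))
    Ψ-∣ t t≤T with orbit-covers t t≤T
    ... | n , refl = subst₂ _∣_ (cong P (ℕ.+-comm sᵣ k)) (sym (Ψ-orbit n)) (P-∣-* sᵣ k ∣-refl (combination-∣ n))

    lead-∤ℤ : ∀ (i : Fin (suc r)) → ¬ P β ∣ + ((d ℕ.^ toℕ i) !) * + lead (toℕ i)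
    lead-∤ℤ i P[β]∣ =
      ^∤-mono (≤-cumulative (λ i → (d ℕ.^ i) ! ℕ.+ lead-exponent d e i) (ℕ.≤-pred (Fin.toℕ<n i)))
      (!*lead-∤ prime p^e∤lc (toℕ i))
      (subst (p ℕ.^ β ℕ.∣_) (cong ℤ.∣_∣ (sym (pos-* ((d ℕ.^ toℕ i) !) (lead (toℕ i))))) (∣⇒∣ᵤ P[β]∣))

    deg : Fin (suc r) → ℕ
    deg i = d ℕ.^ toℕ i

    deg-mono : ∀ {i j} → i Fin.< j → deg i < deg j
    deg-mono = ℕ.^-monoʳ-< d 1<d

    deg≤T : ∀ i → deg i ≤ T
    deg≤T i = ℕ.^-monoʳ-≤ d (ℕ.≤-pred (Fin.toℕ<n i))

    open DifferenceArgument T k β sᵣ deg (λ i → ℕ.m^n>0 d (toℕ i)) deg-mono deg≤T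
      (λ i → s (toℕ i)) w w+s≡sᵣ (λ i t → + H (toℕ i) t) (λ i → + lead (toℕ i)) (λ i → H-poly (toℕ i))
      lead-∤ℤ (λ i → H-∣ (toℕ i)) c cs Ψ-∣

    digit₁≡0 : (y : ℤ[ p ]) → P k ∣ P W * + digit y k → digit y 1 ≡ 0
    digit₁≡0 y P[k]∣ = trans (digit-mod y (s≤s z≤n)) (ℕ.n∣m⇒m%n≡0 _ (p ℕ.^ 1) ⦃ p^≢0 1 ⦄ p^1∣y)
      where
      W+1≤k : W ℕ.+ 1 ≤ k
      W+1≤k = ℕ.≤-trans (ℕ.≤-reflexive (ℕ.+-comm W 1)) (s≤s (ℕ.m≤m+n W T))
      p^W*p∣p^W*y : p ℕ.^ W ℕ.* p ℕ.^ 1 ℕ.∣ p ℕ.^ W ℕ.* digit y k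
      p^W*p∣p^W*y = ℕ.∣-trans (subst (ℕ._∣ p ℕ.^ k) (ℕ.^-distribˡ-+-* p W 1) (^-monoʳ-∣ p W+1≤k))
        (subst (p ℕ.^ k ℕ.∣_) (cong ℤ.∣_∣ (sym (pos-* (p ℕ.^ W) (digit y k)))) (∣⇒∣ᵤ P[k]∣))
      p^1∣y : p ℕ.^ 1 ℕ.∣ digit y k
      p^1∣y = ℕ.*-cancelˡ-∣ (p ℕ.^ W) ⦃ p^≢0 W ⦄ p^W*p∣p^W*y

    contradiction : ⊥
    contradiction = proj₁ (proj₂ (proj₂ (recurrence k)))
      (digit₁≡0 cₚ constant-∣ , λ i → digit₁≡0 (lookup csₚ i) (coefficient-∣ i))

open LinearRecurrence
open import Data.Nat using (suc; zero; s≤s; z≤n; NonTrivial)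
open import Data.Nat.Primality using (prime⇒nonTrivial)
open import Data.Product using (_,_)
open import Data.Empty using (⊥-elim)
open import Relation.Nullary using (¬_)
open import Relation.Binary.PropositionalEquality using (refl; sym; trans)

-- For d = 0 the map induced on ℤ/p is definitionally constant.
constant-map-not-ergodic : ∀ {q} (f : QpPoly (suc (suc q)) 0) → ¬ Ergodic f
constant-map-not-ergodic f ergodic
  with ergodic 1 (s≤s z≤n) 0 1 (s≤s z≤n) (s≤s (s≤s z≤n))
     | ergodic 1 (s≤s z≤n) 1 0 (s≤s (s≤s z≤n)) (s≤s z≤n)
... | suc n , fⁿ⁺¹0≡1 | suc n′ , fⁿ′⁺¹1≡0 with () ← trans (sym fⁿ′⁺¹1≡0) fⁿ⁺¹0≡1

proposition5p1 : (p : ℕ) → Prime p → (d : ℕ) (f : QpPoly p d) → HasDegree f →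
                 IntegerValued f → Compatible f → Ergodic f →
                 (x₀ : ℤ[ p ]) (r : ℕ) → 1 ≤ r → LinearRecurrenceModAll f x₀ r →
                 d ≡ 1
proposition5p1 zero          prime = ⊥-elim (NonTrivial.nonTrivial (prime⇒nonTrivial prime))
proposition5p1 (suc zero)    prime = ⊥-elim (NonTrivial.nonTrivial (prime⇒nonTrivial prime))
proposition5p1 (suc (suc q)) prime zero f _ _ _ ergodic _ _ _ _ = ⊥-elim (constant-map-not-ergodic f ergodic)
proposition5p1 (suc (suc q)) prime (suc zero) _ _ _ _ _ _ _ _ _ = refl
proposition5p1 (suc (suc q)) prime (suc (suc d)) f (e , lc≢0) integer-valued compatible ergodic x₀ r _ recurrence =
  ⊥-elim (Recurrence.contradiction q prime (s≤s (s≤s z≤n)) f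
            integer-valued compatible ergodic x₀ r recurrence lc≢0)
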